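{- For $n\in\mathbb{N}$ and $k\in\{1,\ldots,n\}$ let $\tilde{v}_{n-1}(k-1)=\left(0,\ldots,0,\binom{k-1}{k-1},\binom{k}{k-1},\ldots,\binom{n-1}{k-1}\right)\in\mathbb{R}^n$ (with $k-1$ leading zeros). Then a vector $\tilde{u}\in\mathbb{R}^n$ is a nonnegative real linear combination of $\tilde{v}_{n-1}(0),\ldots,\tilde{v}_{n-1}(n-1)$ if and only if all differences of $\tilde{u}$ are nonnegative, i.e. $\Delta^i(u_k)\ge0$ for all $i\in\{0,\ldots,n-1\}$ and $k\in\{i+1,\ldots,n\}$.
   Context: Iterated backward differences: $\Delta^0(u_k)=u_k$ and $\Delta^i(u_k)=\Delta^{i-1}(u_k)-\Delta^{i-1}(u_{k-1})$ for $i\ge1$, $k\ge i+1$. -}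

module Defs where

open import Level using (Level; _⊔_) renaming (suc to lsuc)
open import Data.Nat as ℕ using (ℕ; zero; suc; _<_; _≤_)
open import Data.Nat.Combinatorics using (_C_)
open import Data.Fin as Fin using (Fin; toℕ; fromℕ<)
open import Data.Product using (Σ; _×_; ∃)
open import Relation.Nullary using (¬_; yes; no)
open import Relation.Binary using (Rel; IsTotalOrder)
open import Algebra.Bundles using (CommutativeRing)

-- Ordered field (the real numbers ℝ are the intended instance; agda-stdlib has no ℝ).
-- A commutative ring with a total order compatible with + and *, and inverses
-- of all nonzero elements.
record OrderedField (c ℓ₁ ℓ₂ : Level) : Set (lsuc (c ⊔ ℓ₁ ⊔ ℓ₂)) where
  field
    commRing : CommutativeRing c ℓ₁
  open CommutativeRing commRing public
  field
    _≤F_          : Rel Carrier ℓ₂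
    isTotalOrder  : IsTotalOrder _≈_ _≤F_
    +-mono-≤F     : ∀ {x y} z → x ≤F y → (x + z) ≤F (y + z)
    *-nonneg      : ∀ {x y} → 0# ≤F x → 0# ≤F y → 0# ≤F (x * y)
    0≉1           : ¬ (0# ≈ 1#)
    inverse       : ∀ x → ¬ (x ≈ 0#) → Σ Carrier λ y → (x * y) ≈ 1#

module _ {c ℓ₁ ℓ₂} (F : OrderedField c ℓ₁ ℓ₂) where
  open OrderedField F

  ι : ℕ → Carrier
  ι zero    = 0#
  ι (suc n) = 1# + ι n

  Σ[_] : ∀ n → (Fin n → Carrier) → Carrier
  Σ[ zero ] f  = 0#
  Σ[ suc n ] f = f Fin.zero + Σ[ n ] (λ j → f (Fin.suc j))

  -- ṽ_{n-1}(j) (0-based j = k-1): its m-th entry (0-based m) is binom(m, j);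
  -- binom(m, j) = 0 for m < j gives the j leading zeros.
  ṽ : ∀ n → Fin n → Fin n → Carrier
  ṽ n j m = ι (toℕ m C toℕ j)

  NonnegComb : ∀ n → (Fin n → Carrier) → Set (c ⊔ ℓ₁ ⊔ ℓ₂)
  NonnegComb n u = Σ (Fin n → Carrier) λ a →
    (∀ j → 0# ≤F a j) × (∀ m → u m ≈ Σ[ n ] (λ j → a j * ṽ n j m))

  -- iterated backward differences on a sequence indexed by ℕ (0-based):
  -- Δ 0 u k = u k,  Δ (i+1) u k = Δ i u k - Δ i u (k-1)   (used only for k ≥ i+1)
  Δ : ℕ → (ℕ → Carrier) → ℕ → Carrier
  Δ zero    u k       = u k
  Δ (suc i) u zero    = 0#   -- never used (requires k ≥ i+1 ≥ 1)
  Δ (suc i) u (suc k) = Δ i u (suc k) - Δ i u k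

  -- view u ∈ Fⁿ as a sequence (values beyond n are irrelevant)
  ext : ∀ n → (Fin n → Carrier) → ℕ → Carrier
  ext n u k with k ℕ.<? n
  ... | yes k<n = u (fromℕ< k<n)
  ... | no  _   = 0#

  -- all differences nonnegative: Δ^i(u_k) ≥ 0 for 0 ≤ i ≤ n-1, i+1 ≤ k ≤ n
  -- (in 0-based indexing: i ≤ k < n)
  AllDiffsNonneg : ∀ n → (Fin n → Carrier) → Set ℓ₂
  AllDiffsNonneg n u = ∀ i k → i ≤ k → k < n → 0# ≤F Δ i (ext n u) k

-- Newton's forward-difference formula expresses every sequence in the binomial basis:
-- u_m = Σ_j Δ^j(u_{j+1}) binom(m, j), so the coefficients of ũ in the basis ṽ(0), …, ṽ(n-1)
-- are the leading differences Δ^j(u_{j+1}); hence ũ is a nonnegative combination iff these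
-- are nonnegative. Conversely the i-th difference of the column binom(·, j) at k is
-- binom(k−i, j−i) ≥ 0, so by linearity of Δ every difference of a nonnegative combination
-- is nonnegative.
module Submission where

open import Defs
open import Data.Nat as ℕ using (ℕ; zero; suc; _≤_; _<_; s≤s)
open import Data.Nat.Properties as ℕ using (≤-refl; m≤n⇒m≤1+n; ≤-<-trans)
open import Data.Nat.Combinatorics using (_C_; k>n⇒nCk≡0; nCk+nC[k+1]≡[n+1]C[k+1])
open import Data.Fin as Fin using (Fin; toℕ; fromℕ<)
open import Data.Fin.Properties using (toℕ<n; toℕ-fromℕ<; fromℕ<-toℕ)
open import Data.Product using (_×_; _,_)
open import Data.Sum using (inj₁; inj₂)
open import Data.Empty using (⊥-elim)
open import Function using (_∘_)
open import Relation.Nullary using (yes; no)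
open import Relation.Binary.PropositionalEquality as ≡ using (_≡_)
open import Relation.Binary.Structures using (IsTotalOrder)
import Algebra.Properties.Ring as RingProperties
import Algebra.Properties.AbelianGroup as AbelianGroupProperties
import Algebra.Properties.CommutativeSemigroup as CommutativeSemigroupProperties
import Relation.Binary.Reasoning.Setoid as SetoidReasoning

-- For i ≤ k this is binom(k − i, j − i), read as 0 when j < i.
binomialDiff : ℕ → ℕ → ℕ → ℕ
binomialDiff zero    j       k       = k C j
binomialDiff (suc i) zero    k       = 0
binomialDiff (suc i) (suc j) zero    = 0
binomialDiff (suc i) (suc j) (suc k) = binomialDiff i j k

binomialDiff-step : ∀ i j k → i ≤ k →
  binomialDiff i j (suc k) ≡ binomialDiff i j k ℕ.+ binomialDiff (suc i) j (suc k)
binomialDiff-step zero    zero    k       _       = ≡.refl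
binomialDiff-step zero    (suc j) k       _       =
  ≡.sym (≡.trans (ℕ.+-comm (k C suc j) (k C j)) (nCk+nC[k+1]≡[n+1]C[k+1] k j))
binomialDiff-step (suc i) zero    (suc k) _       = ≡.refl
binomialDiff-step (suc i) (suc j) (suc k) (s≤s p) = binomialDiff-step i j k p

module _ {c ℓ₁ ℓ₂} (F : OrderedField c ℓ₁ ℓ₂) where
  open OrderedField F
  open IsTotalOrder isTotalOrder using (total)
    renaming (refl to ≤F-refl; trans to ≤F-trans; ≲-respˡ-≈ to ≤F-respˡ-≈; ≲-respʳ-≈ to ≤F-respʳ-≈)
  open RingProperties ring using (-1*x≈-x; x[y-z]≈xy-xz)
  open AbelianGroupProperties +-abelianGroup using (⁻¹-∙-comm; ⁻¹-involutive; xyx⁻¹≈y; ε⁻¹≈ε)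
  open CommutativeSemigroupProperties +-commutativeSemigroup using (interchange)
  open SetoidReasoning setoid

  ιF : ℕ → Carrier
  ιF = ι F

  ∑ : ∀ n → (Fin n → Carrier) → Carrier
  ∑ = Σ[_] F

  ΔF : ℕ → (ℕ → Carrier) → ℕ → Carrier
  ΔF = Δ F

  [x+y]-[z+w]≈[x-z]+[y-w] : ∀ x y z w → (x + y) - (z + w) ≈ (x - z) + (y - w)
  [x+y]-[z+w]≈[x-z]+[y-w] x y z w = trans (+-congˡ (sym (⁻¹-∙-comm z w))) (interchange x y (- z) (- w))

  x≈y+[x-y] : ∀ x y → x ≈ y + (x - y)
  x≈y+[x-y] x y = sym (begin
    y + (x - y)   ≈⟨ +-comm y (x - y) ⟩
    (x - y) + y   ≈⟨ +-assoc x (- y) y ⟩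
    x + (- y + y) ≈⟨ +-congˡ (-‿inverseˡ y) ⟩
    x + 0#        ≈⟨ +-identityʳ x ⟩
    x             ∎)

  ∑-cong : ∀ n {f g : Fin n → Carrier} → (∀ j → f j ≈ g j) → ∑ n f ≈ ∑ n g
  ∑-cong zero    f≈g = refl
  ∑-cong (suc n) f≈g = +-cong (f≈g Fin.zero) (∑-cong n (f≈g ∘ Fin.suc))

  ∑-0 : ∀ n → ∑ n (λ _ → 0#) ≈ 0#
  ∑-0 zero    = refl
  ∑-0 (suc n) = trans (+-identityˡ _) (∑-0 n)

  ∑-distrib-- : ∀ n (f g : Fin n → Carrier) → ∑ n f - ∑ n g ≈ ∑ n (λ j → f j - g j)
  ∑-distrib-- zero    f g = trans (+-congˡ ε⁻¹≈ε) (+-identityʳ 0#)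
  ∑-distrib-- (suc n) f g =
    trans ([x+y]-[z+w]≈[x-z]+[y-w] _ _ _ _) (+-congˡ (∑-distrib-- n _ _))

  sumTo : ℕ → (ℕ → Carrier) → Carrier
  sumTo zero    f = 0#
  sumTo (suc n) f = f 0 + sumTo n (f ∘ suc)

  ∑≡sumTo : ∀ n (f : ℕ → Carrier) → ∑ n (f ∘ toℕ) ≡ sumTo n f
  ∑≡sumTo zero    f = ≡.refl
  ∑≡sumTo (suc n) f = ≡.cong (f 0 +_) (∑≡sumTo n (f ∘ suc))

  sumTo-cong : ∀ n {f g : ℕ → Carrier} → (∀ j → f j ≈ g j) → sumTo n f ≈ sumTo n g
  sumTo-cong zero    f≈g = refl
  sumTo-cong (suc n) f≈g = +-cong (f≈g 0) (sumTo-cong n (f≈g ∘ suc))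

  sumTo-0 : ∀ n → sumTo n (λ _ → 0#) ≈ 0#
  sumTo-0 zero    = refl
  sumTo-0 (suc n) = trans (+-identityˡ _) (sumTo-0 n)

  sumTo-distrib-+ : ∀ n (f g : ℕ → Carrier) → sumTo n (λ j → f j + g j) ≈ sumTo n f + sumTo n g
  sumTo-distrib-+ zero    f g = sym (+-identityʳ 0#)
  sumTo-distrib-+ (suc n) f g =
    trans (+-congˡ (sumTo-distrib-+ n (f ∘ suc) (g ∘ suc))) (interchange _ _ _ _)

  sumTo-snoc : ∀ n (f : ℕ → Carrier) → sumTo (suc n) f ≈ sumTo n f + f n
  sumTo-snoc zero    f = trans (+-identityʳ _) (sym (+-identityˡ _))
  sumTo-snoc (suc n) f = trans (+-congˡ (sumTo-snoc n (f ∘ suc))) (sym (+-assoc _ _ _))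

  sumTo-pascal : ∀ n (x c c′ : ℕ → Carrier) → c′ 0 ≈ c 0 →
    (∀ j → c′ (suc j) ≈ c j + c (suc j)) → c n ≈ 0# →
    sumTo n (λ j → (x j + x (suc j)) * c j) ≈ sumTo (suc n) (λ j → x j * c′ j)
  sumTo-pascal n x c c′ c′0≈c0 c′-step cn≈0 = begin
    sumTo n (λ j → (x j + x (suc j)) * c j)
      ≈⟨ sumTo-cong n (λ j → distribʳ (c j) (x j) (x (suc j))) ⟩
    sumTo n (λ j → x j * c j + x (suc j) * c j)
      ≈⟨ sumTo-distrib-+ n _ _ ⟩
    sumTo n (λ j → x j * c j) + sumTo n (λ j → x (suc j) * c j)
      ≈⟨ +-congʳ lastTermVanishes ⟨
    sumTo (suc n) (λ j → x j * c j) + sumTo n (λ j → x (suc j) * c j)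
      ≈⟨ +-assoc _ _ _ ⟩
    x 0 * c 0 + (sumTo n (λ j → x (suc j) * c (suc j)) + sumTo n (λ j → x (suc j) * c j))
      ≈⟨ +-cong (*-congˡ (sym c′0≈c0)) (trans (+-comm _ _) (sym (sumTo-distrib-+ n _ _))) ⟩
    x 0 * c′ 0 + sumTo n (λ j → x (suc j) * c j + x (suc j) * c (suc j))
      ≈⟨ +-congˡ (sumTo-cong n (λ j → trans (sym (distribˡ _ _ _)) (*-congˡ (sym (c′-step j))))) ⟩
    sumTo (suc n) (λ j → x j * c′ j) ∎
    where
    lastTermVanishes : sumTo (suc n) (λ j → x j * c j) ≈ sumTo n (λ j → x j * c j)
    lastTermVanishes = trans (sumTo-snoc n _)
      (trans (+-congˡ (trans (*-congˡ cn≈0) (zeroʳ _))) (+-identityʳ _))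

  +-nonneg : ∀ {x y} → 0# ≤F x → 0# ≤F y → 0# ≤F (x + y)
  +-nonneg {x} {y} 0≤x 0≤y =
    ≤F-respˡ-≈ (+-identityʳ 0#)
      (≤F-trans (+-mono-≤F 0# 0≤x)
        (≤F-respˡ-≈ (sym (trans (+-identityʳ x) (sym (+-identityˡ x))))
          (≤F-respʳ-≈ (+-comm y x) (+-mono-≤F x 0≤y))))

  -- If 1 ≤ 0 then 0 ≤ -1, and 1 = (-1)(-1) is a product of nonnegatives.
  0≤1 : 0# ≤F 1#
  0≤1 with total 0# 1#
  ... | inj₁ 0≤1 = 0≤1
  ... | inj₂ 1≤0 = ≤F-respʳ-≈ -1*-1≈1 (*-nonneg 0≤-1 0≤-1)
    where
    0≤-1 : 0# ≤F (- 1#)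
    0≤-1 = ≤F-respˡ-≈ (-‿inverseʳ 1#) (≤F-respʳ-≈ (+-identityˡ (- 1#)) (+-mono-≤F (- 1#) 1≤0))
    -1*-1≈1 : (- 1#) * (- 1#) ≈ 1#
    -1*-1≈1 = trans (-1*x≈-x (- 1#)) (⁻¹-involutive 1#)

  ι-nonneg : ∀ m → 0# ≤F ιF m
  ι-nonneg zero    = ≤F-refl
  ι-nonneg (suc m) = +-nonneg 0≤1 (ι-nonneg m)

  ι-homo-+ : ∀ a b → ιF (a ℕ.+ b) ≈ ιF a + ιF b
  ι-homo-+ zero    b = sym (+-identityˡ _)
  ι-homo-+ (suc a) b = trans (+-congˡ (ι-homo-+ a b)) (sym (+-assoc _ _ _))

  ι-pascal : ∀ m j → ιF (suc m C suc j) ≈ ιF (m C j) + ιF (m C suc j)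
  ι-pascal m j = trans (reflexive (≡.cong ιF (≡.sym (nCk+nC[k+1]≡[n+1]C[k+1] m j))))
                       (ι-homo-+ (m C j) (m C suc j))

  ∑-nonneg : ∀ n (f : Fin n → Carrier) → (∀ j → 0# ≤F f j) → 0# ≤F ∑ n f
  ∑-nonneg zero    f 0≤f = ≤F-refl
  ∑-nonneg (suc n) f 0≤f = +-nonneg (0≤f Fin.zero) (∑-nonneg n (f ∘ Fin.suc) (0≤f ∘ Fin.suc))

  Δ-cong : ∀ {w w′} i k → (∀ t → t ≤ k → w t ≈ w′ t) → ΔF i w k ≈ ΔF i w′ k
  Δ-cong zero    k       w≈w′ = w≈w′ k ≤-refl
  Δ-cong (suc i) zero    w≈w′ = refl
  Δ-cong (suc i) (suc k) w≈w′ =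
    +-cong (Δ-cong i (suc k) w≈w′) (-‿cong (Δ-cong i k (λ t t≤k → w≈w′ t (m≤n⇒m≤1+n t≤k))))

  Δ-∑ : ∀ n (f : Fin n → ℕ → Carrier) i k →
    ΔF i (λ t → ∑ n (λ j → f j t)) k ≈ ∑ n (λ j → ΔF i (f j) k)
  Δ-∑ n f zero    k       = refl
  Δ-∑ n f (suc i) zero    = sym (∑-0 n)
  Δ-∑ n f (suc i) (suc k) =
    trans (+-cong (Δ-∑ n f i (suc k)) (-‿cong (Δ-∑ n f i k))) (∑-distrib-- n _ _)

  Δ-*ˡ : ∀ a (f : ℕ → Carrier) i k → ΔF i (λ t → a * f t) k ≈ a * ΔF i f k
  Δ-*ˡ a f zero    k       = refl
  Δ-*ˡ a f (suc i) zero    = sym (zeroʳ a)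
  Δ-*ˡ a f (suc i) (suc k) =
    trans (+-cong (Δ-*ˡ a f i (suc k)) (-‿cong (Δ-*ˡ a f i k))) (sym (x[y-z]≈xy-xz a _ _))

  Δ-step : ∀ (w : ℕ → Carrier) i k → ΔF i w (suc k) ≈ ΔF i w k + ΔF (suc i) w (suc k)
  Δ-step w i k = x≈y+[x-y] (ΔF i w (suc k)) (ΔF i w k)

  Δ-shift : ∀ (w : ℕ → Carrier) i k → i ≤ k → ΔF i w (suc k) ≡ ΔF i (w ∘ suc) k
  Δ-shift w zero    k       _       = ≡.refl
  Δ-shift w (suc i) (suc k) (s≤s p) =
    ≡.cong₂ _-_ (Δ-shift w i (suc k) (m≤n⇒m≤1+n p)) (Δ-shift w i k p)

  Δ-binomial : ∀ i j k → i ≤ k → ΔF i (λ t → ιF (t C j)) k ≈ ιF (binomialDiff i j k)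
  Δ-binomial zero    j k       _       = refl
  Δ-binomial (suc i) j (suc k) (s≤s p) = begin
    ΔF i f (suc k) - ΔF i f k
      ≈⟨ +-cong (Δ-binomial i j (suc k) (m≤n⇒m≤1+n p)) (-‿cong (Δ-binomial i j k p)) ⟩
    ιF (binomialDiff i j (suc k)) - ιF (binomialDiff i j k)
      ≈⟨ +-congʳ (reflexive (≡.cong ιF (binomialDiff-step i j k p))) ⟩
    ιF (binomialDiff i j k ℕ.+ binomialDiff (suc i) j (suc k)) - ιF (binomialDiff i j k)
      ≈⟨ +-congʳ (ι-homo-+ (binomialDiff i j k) (binomialDiff (suc i) j (suc k))) ⟩
    (ιF (binomialDiff i j k) + ιF (binomialDiff (suc i) j (suc k))) - ιF (binomialDiff i j k)
      ≈⟨ xyx⁻¹≈y _ _ ⟩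
    ιF (binomialDiff (suc i) j (suc k)) ∎
    where
    f : ℕ → Carrier
    f t = ιF (t C j)

  newton-forward : ∀ (w : ℕ → Carrier) m N → m < N →
    w m ≈ sumTo N (λ j → ΔF j w j * ιF (m C j))
  newton-forward w zero (suc N) _ = sym (begin
    w 0 * ιF 1 + sumTo N (λ j → ΔF (suc j) w (suc j) * 0#)
      ≈⟨ +-cong (*-congˡ (+-identityʳ 1#)) (sumTo-cong N (λ j → zeroʳ _)) ⟩
    w 0 * 1# + sumTo N (λ _ → 0#)
      ≈⟨ +-cong (*-identityʳ _) (sumTo-0 N) ⟩
    w 0 + 0#
      ≈⟨ +-identityʳ _ ⟩
    w 0 ∎)
  newton-forward w (suc m) (suc N) (s≤s m<N) = begin
    w (suc m)
      ≈⟨ newton-forward (w ∘ suc) m N m<N ⟩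
    sumTo N (λ j → ΔF j (w ∘ suc) j * ιF (m C j))
      ≈⟨ sumTo-cong N (λ j → *-congʳ (trans (reflexive (≡.sym (Δ-shift w j j ≤-refl))) (Δ-step w j j))) ⟩
    sumTo N (λ j → (ΔF j w j + ΔF (suc j) w (suc j)) * ιF (m C j))
      ≈⟨ sumTo-pascal N (λ j → ΔF j w j) (λ j → ιF (m C j)) (λ j → ιF (suc m C j))
           refl (ι-pascal m) (reflexive (≡.cong ιF (k>n⇒nCk≡0 m<N))) ⟩
    sumTo (suc N) (λ j → ΔF j w j * ιF (suc m C j)) ∎

  ext-< : ∀ n u k (k<n : k < n) → ext F n u k ≡ u (fromℕ< k<n)
  ext-< n u k k<n with k ℕ.<? n
  ... | yes _   = ≡.refl
  ... | no  k≮n = ⊥-elim (k≮n k<n)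

  nonnegComb⇒allDiffsNonneg : ∀ n u → NonnegComb F n u → AllDiffsNonneg F n u
  nonnegComb⇒allDiffsNonneg n u (a , 0≤a , u≈∑) i k i≤k k<n =
    ≤F-respʳ-≈ (sym Δu≈∑)
      (∑-nonneg n _ (λ j → *-nonneg (0≤a j) (ι-nonneg (binomialDiff i (toℕ j) k))))
    where
    w : ℕ → Carrier
    w t = ∑ n (λ j → a j * ιF (t C toℕ j))
    ext≈w : ∀ t → t < n → ext F n u t ≈ w t
    ext≈w t t<n = trans (reflexive (ext-< n u t t<n))
      (trans (u≈∑ (fromℕ< t<n)) (reflexive (≡.cong w (toℕ-fromℕ< t<n))))
    Δu≈∑ : ΔF i (ext F n u) k ≈ ∑ n (λ j → a j * ιF (binomialDiff i (toℕ j) k))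
    Δu≈∑ = begin
      ΔF i (ext F n u) k
        ≈⟨ Δ-cong i k (λ t t≤k → ext≈w t (≤-<-trans t≤k k<n)) ⟩
      ΔF i w k
        ≈⟨ Δ-∑ n (λ j t → a j * ιF (t C toℕ j)) i k ⟩
      ∑ n (λ j → ΔF i (λ t → a j * ιF (t C toℕ j)) k)
        ≈⟨ ∑-cong n (λ j → trans (Δ-*ˡ (a j) _ i k) (*-congˡ (Δ-binomial i (toℕ j) k i≤k))) ⟩
      ∑ n (λ j → a j * ιF (binomialDiff i (toℕ j) k)) ∎

  allDiffsNonneg⇒nonnegComb : ∀ n u → AllDiffsNonneg F n u → NonnegComb F n u
  allDiffsNonneg⇒nonnegComb n u 0≤Δ = a , 0≤a , u≈∑
    where
    w : ℕ → Carrier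
    w = ext F n u
    a : Fin n → Carrier
    a j = ΔF (toℕ j) w (toℕ j)
    0≤a : ∀ j → 0# ≤F a j
    0≤a j = 0≤Δ (toℕ j) (toℕ j) ≤-refl (toℕ<n j)
    u≈∑ : ∀ m → u m ≈ ∑ n (λ j → a j * ṽ F n j m)
    u≈∑ m = begin
      u m                 ≡⟨ ≡.cong u (fromℕ<-toℕ m (toℕ<n m)) ⟨
      u (fromℕ< _)        ≡⟨ ext-< n u (toℕ m) (toℕ<n m) ⟨
      w (toℕ m)           ≈⟨ newton-forward w (toℕ m) n (toℕ<n m) ⟩
      sumTo n (λ j → ΔF j w j * ιF (toℕ m C j))
                          ≡⟨ ∑≡sumTo n (λ j → ΔF j w j * ιF (toℕ m C j)) ⟨
      ∑ n (λ j → a j * ṽ F n j m) ∎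

lemma3p6 : ∀ {c ℓ₁ ℓ₂} (F : OrderedField c ℓ₁ ℓ₂) (n : ℕ) (u : Fin n → OrderedField.Carrier F) →
    (NonnegComb F n u → AllDiffsNonneg F n u) × (AllDiffsNonneg F n u → NonnegComb F n u)
lemma3p6 F n u = nonnegComb⇒allDiffsNonneg F n u , allDiffsNonneg⇒nonnegComb F n u
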